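{- Let $G$ be the $(n\times n)$-grid and suppose $Q\subseteq V_1$ is a pyramidal set. Then $$\delta(Q)=|Q|-|Q\cap X_n|+|N(Q\cap X_1)\cap \overline{X}_1|.$$
   Context: The $(n\times n)$-grid $G$ has vertex set $\{(x,y): x,y\in\mathbb Z,\ 1\le x,y\le n\}$, with $(x,y)$ adjacent to $(x',y')$ iff $|x-x'|+|y-y'|=1$. $V_1=\{(x,y): x+y \text{ even}\}$, $V_2=\{(x,y): x+y\text{ odd}\}$. For $S\subseteq V(G)$, $N(S)=\bigcup_{v\in S}N(v)\setminus S$ and $\delta(S)=|N(S)|$. A set $Q\subseteq V_1$ is pyramidal if for every $(x,y)\in Q$ with $y\ge2$ we have $(x-1,y-1)\in Q$ whenever $x\ge2$, and $(x+1,y-1)\in Q$ whenever $x\le n-1$. For $i\in\{1,\ldots,n\}$, $R_i=\{(x,i):1\le x\le n\}$, $X_i=R_i\cap V_1$ and $\overline X_i=R_i\cap V_2$. -}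

module Defs where

open import Data.Nat using (ℕ; zero; suc; _+_; _∸_; _≤_; _≡ᵇ_; _≤ᵇ_; _%_; ∣_-_∣)
open import Data.Bool using (Bool; true; false; _∧_; _∨_; not; if_then_else_)
open import Data.List using (List; []; _∷_; map; concatMap; upTo)
open import Data.Nat.ListAction using (sum)
open import Data.Bool.ListAction using (any)
open import Data.Product using (_×_; _,_)
open import Relation.Binary.PropositionalEquality using (_≡_)

VSet : Set
VSet = ℕ → ℕ → Bool

coords : ℕ → List ℕ
coords n = map suc (upTo n)

gridVerts : ℕ → List (ℕ × ℕ)
gridVerts n = concatMap (λ x → map (λ y → (x , y)) (coords n)) (coords n)

inGrid : ℕ → ℕ → ℕ → Bool
inGrid n x y = (1 ≤ᵇ x) ∧ (x ≤ᵇ n) ∧ (1 ≤ᵇ y) ∧ (y ≤ᵇ n)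

adj : ℕ → ℕ → ℕ → ℕ → Bool
adj x y x' y' = (∣ x - x' ∣ + ∣ y - y' ∣) ≡ᵇ 1

evenB : ℕ → Bool
evenB m = (m % 2) ≡ᵇ 0

V₁ : ℕ → VSet
V₁ n x y = inGrid n x y ∧ evenB (x + y)

V₂ : ℕ → VSet
V₂ n x y = inGrid n x y ∧ not (evenB (x + y))

R : ℕ → ℕ → VSet
R n i x y = inGrid n x y ∧ (y ≡ᵇ i)

X : ℕ → ℕ → VSet
X n i x y = R n i x y ∧ V₁ n x y

Xbar : ℕ → ℕ → VSet
Xbar n i x y = R n i x y ∧ V₂ n x y

_∩_ : VSet → VSet → VSet
(A ∩ B) x y = A x y ∧ B x y

card : ℕ → VSet → ℕ
card n S = sum (map (λ { (x , y) → if S x y then 1 else 0 }) (gridVerts n))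

Nb : ℕ → VSet → VSet
Nb n S x y = inGrid n x y ∧ not (S x y)
  ∧ any (λ { (u , w) → S u w ∧ adj u w x y }) (gridVerts n)

δ : ℕ → VSet → ℕ
δ n S = card n (Nb n S)

_⊆V₁_ : VSet → ℕ → Set
Q ⊆V₁ n = ∀ x y → Q x y ≡ true → V₁ n x y ≡ true

Pyramidal : ℕ → VSet → Set
Pyramidal n Q = ∀ x y → Q x y ≡ true → 2 ≤ y →
  ((2 ≤ x → Q (x ∸ 1) (y ∸ 1) ≡ true) × (x ≤ n ∸ 1 → Q (x + 1) (y ∸ 1) ≡ true))

module Submission where

-- The proof is a pointwise identification of N(Q) followed by counting.
-- Pointwise (module PyramidalSet):
--   * a vertex (x , y+1) with y ≥ 1 lies in N(Q) iff (x , y) ∈ Q: the vertex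
--     below a point of Q is a neighbour of it (parity keeps it outside Q), and
--     conversely every neighbour of Q forces, by pyramidality, the vertex
--     directly below it into Q;
--   * a vertex (x , 1) of the bottom row lies in N(Q) iff it lies in
--     N(Q ∩ X₁) ∩ X̄₁, because every such neighbour already has a horizontal
--     neighbour in Q ∩ X₁.
-- Counting: cardinalities are rewritten as double sums over the grid indices;
-- the first fact shifts rows 2 … n of N(Q) onto rows 1 … n−1 of Q, whose
-- size is |Q| − |Q ∩ Xₙ|, and the second fact contributes the last summand.

open import Defs
open import Data.Nat using (ℕ; zero; suc; _+_; _∸_; _≤_; _<_; z≤n; s≤s; _≡ᵇ_; _≤ᵇ_; _%_; ∣_-_∣)
open import Data.Nat.Properties
  using (+-identityʳ; +-comm; +-assoc; +-suc; +-commutativeSemigroup; m+n∸n≡m; suc-injective;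
         ≤-trans; <⇒≢; ∸-monoˡ-≤; ≤ᵇ⇒≤; ≤⇒≤ᵇ; ≡ᵇ⇒≡; ≡⇒≡ᵇ; ∣n-n∣≡0; ∣-∣-comm; ∣m-n∣≡0⇒m≡n)
open import Data.Nat.DivMod using ([m+n]%n≡m%n)
open import Algebra.Properties.CommutativeSemigroup +-commutativeSemigroup using (interchange)
open import Data.Bool using (Bool; true; false; _∧_; not; if_then_else_; T)
open import Data.Bool.Properties using (T-≡; ⇔→≡)
open import Data.List using (List; []; _∷_; _++_; map; concatMap; applyUpTo)
open import Data.List.Properties using (map-∘; map-++; map-applyUpTo)
open import Data.List.Membership.Propositional using (_∈_; lose)
open import Data.List.Membership.Propositional.Properties using (∈-map⁺; ∈-upTo⁺)
open import Data.List.Relation.Unary.Any using (satisfied)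
open import Data.List.Relation.Unary.Any.Properties using (any⁺; any⁻; concatMap⁺)
open import Data.Nat.ListAction using (sum)
open import Data.Nat.ListAction.Properties using (sum-++)
open import Data.Bool.ListAction using (any)
open import Data.Product using (_×_; _,_; ∃; ∃₂; proj₁; proj₂)
open import Data.Sum using (_⊎_; inj₁; inj₂)
open import Data.Empty using (⊥-elim)
open import Function using (_∘_; Equivalence; mk⇔)
open import Relation.Binary.PropositionalEquality
  using (_≡_; _≢_; refl; sym; trans; cong; cong₂; subst; module ≡-Reasoning)

open ≡-Reasoning

-- ∑ n g = g 0 + … + g (n − 1); it unfolds as ∑ (suc n) g = g 0 + ∑ n (g ∘ suc).
∑ : ℕ → (ℕ → ℕ) → ℕ
∑ n g = sum (applyUpTo g n)

∑-cong : ∀ n {g h : ℕ → ℕ} → (∀ i → i < n → g i ≡ h i) → ∑ n g ≡ ∑ n h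
∑-cong zero    _  = refl
∑-cong (suc n) eq = cong₂ _+_ (eq 0 (s≤s z≤n)) (∑-cong n (λ i i<n → eq (suc i) (s≤s i<n)))

∑-vanish : ∀ n {g : ℕ → ℕ} → (∀ i → i < n → g i ≡ 0) → ∑ n g ≡ 0
∑-vanish zero    _  = refl
∑-vanish (suc n) eq = cong₂ _+_ (eq 0 (s≤s z≤n)) (∑-vanish n (λ i i<n → eq (suc i) (s≤s i<n)))

∑-+ : ∀ n (g h : ℕ → ℕ) → ∑ n (λ i → g i + h i) ≡ ∑ n g + ∑ n h
∑-+ zero    g h = refl
∑-+ (suc n) g h = trans (cong (g 0 + h 0 +_) (∑-+ n (g ∘ suc) (h ∘ suc)))
                        (interchange (g 0) (h 0) (∑ n (g ∘ suc)) (∑ n (h ∘ suc)))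

∑-snoc : ∀ n (g : ℕ → ℕ) → ∑ (suc n) g ≡ ∑ n g + g n
∑-snoc zero    g = +-comm (g 0) 0
∑-snoc (suc n) g = trans (cong (g 0 +_) (∑-snoc n (g ∘ suc))) (sym (+-assoc (g 0) _ _))

ind : Bool → ℕ
ind b = if b then 1 else 0

ind-false : ∀ {b} → b ≢ true → ind b ≡ 0
ind-false {true}  b≢true = ⊥-elim (b≢true refl)
ind-false {false} _      = refl

sum-concatMap : ∀ {A B : Set} (g : B → ℕ) (F : A → List B) (xs : List A) →
  sum (map g (concatMap F xs)) ≡ sum (map (λ x → sum (map g (F x))) xs)
sum-concatMap g F []       = refl
sum-concatMap g F (x ∷ xs) = begin
  sum (map g (F x ++ concatMap F xs))             ≡⟨ cong sum (map-++ g (F x) _) ⟩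
  sum (map g (F x) ++ map g (concatMap F xs))     ≡⟨ sum-++ (map g (F x)) _ ⟩
  sum (map g (F x)) + sum (map g (concatMap F xs)) ≡⟨ cong (sum (map g (F x)) +_) (sum-concatMap g F xs) ⟩
  sum (map g (F x)) + sum (map (λ x → sum (map g (F x))) xs) ∎

sum-coords : (h : ℕ → ℕ) (n : ℕ) → sum (map h (coords n)) ≡ ∑ n (h ∘ suc)
sum-coords h n = cong sum (trans (cong (map h) (map-applyUpTo (λ i → i) suc n)) (map-applyUpTo suc h n))

sum-grid : (g : ℕ × ℕ → ℕ) (n : ℕ) →
  sum (map g (gridVerts n)) ≡ ∑ n (λ i → ∑ n (λ j → g (suc i , suc j)))
sum-grid g n = begin
  sum (map g (gridVerts n))                        ≡⟨ sum-concatMap g column (coords n) ⟩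
  sum (map (λ x → sum (map g (column x))) (coords n)) ≡⟨ sum-coords _ n ⟩
  ∑ n (λ i → sum (map g (column (suc i))))           ≡⟨ ∑-cong n (λ i _ → column-sum (suc i)) ⟩
  ∑ n (λ i → ∑ n (λ j → g (suc i , suc j)))          ∎
  where
  column : ℕ → List (ℕ × ℕ)
  column x = map (λ y → (x , y)) (coords n)
  column-sum : ∀ x → sum (map g (column x)) ≡ ∑ n (λ j → g (x , suc j))
  column-sum x = trans (cong sum (sym (map-∘ (coords n)))) (sum-coords (λ y → g (x , y)) n)

card-as-∑ : ∀ n (S : VSet) → card n S ≡ ∑ n (λ i → ∑ n (λ j → ind (S (suc i) (suc j))))
card-as-∑ n S = sum-grid _ n

card-split-top : ∀ m (S : VSet) → card (suc m) S ≡
  ∑ (suc m) (λ i → ∑ m (λ j → ind (S (suc i) (suc j)))) + ∑ (suc m) (λ i → ind (S (suc i) (suc m)))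
card-split-top m S = begin
  card (suc m) S                                                      ≡⟨ card-as-∑ (suc m) S ⟩
  ∑ (suc m) (λ i → ∑ (suc m) (λ j → ind (S (suc i) (suc j))))         ≡⟨ ∑-cong (suc m) (λ i _ → ∑-snoc m (entry i)) ⟩
  ∑ (suc m) (λ i → ∑ m (λ j → ind (S (suc i) (suc j))) + ind (S (suc i) (suc m))) ≡⟨ ∑-+ (suc m) (λ i → ∑ m (entry i)) (λ i → entry i m) ⟩
  ∑ (suc m) (λ i → ∑ m (λ j → ind (S (suc i) (suc j)))) + ∑ (suc m) (λ i → ind (S (suc i) (suc m))) ∎
  where
  entry : ℕ → ℕ → ℕ
  entry i j = ind (S (suc i) (suc j))

T⇒true : ∀ {b} → T b → b ≡ true
T⇒true = Equivalence.to T-≡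

true⇒T : ∀ {b} → b ≡ true → T b
true⇒T = Equivalence.from T-≡

∧-elimˡ : ∀ {a b} → a ∧ b ≡ true → a ≡ true
∧-elimˡ {true} _ = refl

∧-elimʳ : ∀ {a b} → a ∧ b ≡ true → b ≡ true
∧-elimʳ {true} b≡true = b≡true

∧-intro : ∀ {a b} → a ≡ true → b ≡ true → a ∧ b ≡ true
∧-intro refl b≡true = b≡true

not-intro : ∀ {a} → a ≢ true → not a ≡ true
not-intro {true}  a≢true = ⊥-elim (a≢true refl)
not-intro {false} _      = refl

not-elim : ∀ {a} → not a ≡ true → a ≢ true
not-elim {false} _ ()

bool-ext : ∀ {a b} → (a ≡ true → b ≡ true) → (b ≡ true → a ≡ true) → a ≡ b
bool-ext to from = ⇔→≡ (mk⇔ to from)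

evenB-+2 : ∀ m → evenB (2 + m) ≡ evenB m
evenB-+2 m = cong (_≡ᵇ 0) (trans (cong (_% 2) (+-comm 2 m)) ([m+n]%n≡m%n m 2))

consecutive-not-even : ∀ m → evenB m ≡ true → evenB (suc m) ≢ true
consecutive-not-even zero          _  ()
consecutive-not-even (suc zero)    ()
consecutive-not-even (suc (suc m)) e₀ e₁ =
  consecutive-not-even m (trans (sym (evenB-+2 m)) e₀) (trans (sym (evenB-+2 (suc m))) e₁)

inGrid-intro : ∀ {n x y} → 1 ≤ x → x ≤ n → 1 ≤ y → y ≤ n → inGrid n x y ≡ true
inGrid-intro a b c d = ∧-intro (T⇒true (≤⇒≤ᵇ a)) (∧-intro (T⇒true (≤⇒≤ᵇ b))
                         (∧-intro (T⇒true (≤⇒≤ᵇ c)) (T⇒true (≤⇒≤ᵇ d))))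

inGrid-bounds : ∀ {n x y} → inGrid n x y ≡ true → 1 ≤ x × x ≤ n × 1 ≤ y × y ≤ n
inGrid-bounds {n} {x} {y} g =
  ≤ᵇ-sound (∧-elimˡ g) , ≤ᵇ-sound (∧-elimˡ g₁) , ≤ᵇ-sound (∧-elimˡ g₂) , ≤ᵇ-sound (∧-elimʳ g₂)
  where
  g₁ : ((x ≤ᵇ n) ∧ (1 ≤ᵇ y) ∧ (y ≤ᵇ n)) ≡ true
  g₁ = ∧-elimʳ {1 ≤ᵇ x} g
  g₂ : ((1 ≤ᵇ y) ∧ (y ≤ᵇ n)) ≡ true
  g₂ = ∧-elimʳ {x ≤ᵇ n} g₁
  ≤ᵇ-sound : ∀ {a b} → (a ≤ᵇ b) ≡ true → a ≤ b
  ≤ᵇ-sound {a} {b} e = ≤ᵇ⇒≤ a b (true⇒T e)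

R-row : ∀ {n k x y} → R n k x y ≡ true → y ≡ k
R-row {k = k} {y = y} e = ≡ᵇ⇒≡ y k (true⇒T (∧-elimʳ e))

X-row : ∀ {n k x y} → X n k x y ≡ true → y ≡ k
X-row {n} {k} {x} {y} e = R-row {n} {k} {x} {y} (∧-elimˡ {R n k x y} e)

Xbar-row : ∀ {n k x y} → Xbar n k x y ≡ true → y ≡ k
Xbar-row {n} {k} {x} {y} e = R-row {n} {k} {x} {y} (∧-elimˡ {R n k x y} e)

X-intro : ∀ {n k x} → V₁ n x k ≡ true → X n k x k ≡ true
X-intro {n} {k} {x} v = ∧-intro (∧-intro {inGrid n x k} (∧-elimˡ v) (T⇒true (≡⇒≡ᵇ k k refl))) v

Xbar-intro : ∀ {n k x} → inGrid n x k ≡ true → evenB (x + k) ≢ true → Xbar n k x k ≡ true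
Xbar-intro {k = k} g odd = ∧-intro (∧-intro g (T⇒true (≡⇒≡ᵇ k k refl))) (∧-intro g (not-intro odd))

Xbar-odd : ∀ {n k x y} → Xbar n k x y ≡ true → evenB (x + y) ≢ true
Xbar-odd {n} {k} {x} {y} e = not-elim (∧-elimʳ {inGrid n x y} (∧-elimʳ {R n k x y} e))

∈-gridVerts : ∀ {n x y} → inGrid n x y ≡ true → (x , y) ∈ gridVerts n
∈-gridVerts {n} {x} {y} g with inGrid-bounds g
... | 1≤x , x≤n , 1≤y , y≤n =
  concatMap⁺ column {P = (x , y) ≡_} (lose (∈-coords 1≤x x≤n) (∈-map⁺ (λ y′ → (x , y′)) (∈-coords 1≤y y≤n)))
  where
  column : ℕ → List (ℕ × ℕ)
  column x′ = map (λ y′ → (x′ , y′)) (coords n)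
  ∈-coords : ∀ {z} → 1 ≤ z → z ≤ n → z ∈ coords n
  ∈-coords {suc i} _ i<n = ∈-map⁺ suc (∈-upTo⁺ i<n)

data Adj : ℕ → ℕ → ℕ → ℕ → Set where
  right : ∀ x y → Adj (suc x) y x y
  left  : ∀ x y → Adj x y (suc x) y
  above : ∀ x y → Adj x (suc y) x y
  below : ∀ x y → Adj x y x (suc y)

∣n-1+n∣≡1 : ∀ n → ∣ n - suc n ∣ ≡ 1
∣n-1+n∣≡1 zero    = refl
∣n-1+n∣≡1 (suc n) = ∣n-1+n∣≡1 n

Adj-distance : ∀ {u w x y} → Adj u w x y → ∣ u - x ∣ + ∣ w - y ∣ ≡ 1
Adj-distance (right x y) = cong₂ _+_ (trans (∣-∣-comm (suc x) x) (∣n-1+n∣≡1 x)) (∣n-n∣≡0 y)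
Adj-distance (left x y)  = cong₂ _+_ (∣n-1+n∣≡1 x) (∣n-n∣≡0 y)
Adj-distance (above x y) = cong₂ _+_ (∣n-n∣≡0 x) (trans (∣-∣-comm (suc y) y) (∣n-1+n∣≡1 y))
Adj-distance (below x y) = cong₂ _+_ (∣n-n∣≡0 x) (∣n-1+n∣≡1 y)

adj-intro : ∀ {u w x y} → Adj u w x y → adj u w x y ≡ true
adj-intro a = cong (_≡ᵇ 1) (Adj-distance a)

consecutive : ∀ a b → ∣ a - b ∣ ≡ 1 → a ≡ suc b ⊎ suc a ≡ b
consecutive zero    b       e = inj₂ (sym e)
consecutive (suc a) zero    e = inj₁ (cong suc (suc-injective e))
consecutive (suc a) (suc b) e with consecutive a b e
... | inj₁ a≡1+b = inj₁ (cong suc a≡1+b)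
... | inj₂ 1+a≡b = inj₂ (cong suc 1+a≡b)

unit-sum : ∀ p q → p + q ≡ 1 → (p ≡ 0 × q ≡ 1) ⊎ (p ≡ 1 × q ≡ 0)
unit-sum zero          q       e = inj₁ (refl , e)
unit-sum (suc zero)    zero    _ = inj₂ (refl , refl)
unit-sum (suc zero)    (suc q) ()
unit-sum (suc (suc p)) q       ()

Adj-vertical : ∀ {u w x y} → u ≡ x → w ≡ suc y ⊎ suc w ≡ y → Adj u w x y
Adj-vertical refl (inj₁ refl) = above _ _
Adj-vertical refl (inj₂ refl) = below _ _

Adj-horizontal : ∀ {u w x y} → u ≡ suc x ⊎ suc u ≡ x → w ≡ y → Adj u w x y
Adj-horizontal (inj₁ refl) refl = right _ _
Adj-horizontal (inj₂ refl) refl = left _ _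

adj-view : ∀ {u w x y} → adj u w x y ≡ true → Adj u w x y
adj-view {u} {w} {x} {y} e with unit-sum ∣ u - x ∣ ∣ w - y ∣ (≡ᵇ⇒≡ _ 1 (true⇒T e))
... | inj₁ (du , dw) = Adj-vertical (∣m-n∣≡0⇒m≡n du) (consecutive w y dw)
... | inj₂ (du , dw) = Adj-horizontal (consecutive u x du) (∣m-n∣≡0⇒m≡n dw)

Adj-parity : ∀ {u w x y} → Adj u w x y → evenB (u + w) ≡ true → evenB (x + y) ≢ true
Adj-parity (right x y) e₀ e₁ = consecutive-not-even (x + y) e₁ e₀
Adj-parity (left x y)  e₀ e₁ = consecutive-not-even (x + y) e₀ e₁
Adj-parity (above x y) e₀ e₁ = consecutive-not-even (x + y) e₁ (trans (cong evenB (sym (+-suc x y))) e₀)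
Adj-parity (below x y) e₀ e₁ = consecutive-not-even (x + y) e₀ (trans (cong evenB (sym (+-suc x y))) e₁)

any-true : ∀ {A : Set} {p : A → Bool} {v : A} {xs : List A} → v ∈ xs → p v ≡ true → any p xs ≡ true
any-true {p = p} v∈xs pv = T⇒true (any⁺ p (lose v∈xs (true⇒T pv)))

Nb-intro : ∀ {n S x y u w} → inGrid n x y ≡ true → S x y ≢ true →
  inGrid n u w ≡ true → S u w ≡ true → Adj u w x y → Nb n S x y ≡ true
Nb-intro {n} {u = u} {w = w} xy∈G xy∉S uw∈G uw∈S a =
  ∧-intro xy∈G (∧-intro (not-intro xy∉S) (any-true (∈-gridVerts {n} {u} {w} uw∈G) (∧-intro uw∈S (adj-intro a))))

Nb-inGrid : ∀ {n S x y} → Nb n S x y ≡ true → inGrid n x y ≡ true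
Nb-inGrid = ∧-elimˡ

Nb-outside : ∀ {n S x y} → Nb n S x y ≡ true → S x y ≢ true
Nb-outside {n} {x = x} {y = y} e = not-elim (∧-elimˡ (∧-elimʳ {inGrid n x y} e))

Neighbour : VSet → ℕ → ℕ → Set
Neighbour S x y = ∃₂ λ u w → S u w ≡ true × Adj u w x y

Nb-neighbour : ∀ {n S x y} → Nb n S x y ≡ true → Neighbour S x y
Nb-neighbour {n} {S} {x} {y} e
  with satisfied (any⁻ _ (gridVerts n) (true⇒T (∧-elimʳ {not (S x y)} (∧-elimʳ {inGrid n x y} e))))
... | (u , w) , uw∈S∧adj = u , w , ∧-elimˡ p , adj-view (∧-elimʳ {S u w} p)
  where
  p : S u w ∧ adj u w x y ≡ true
  p = T⇒true uw∈S∧adj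

module PyramidalSet (n : ℕ) (Q : VSet) (Q⊆V₁ : Q ⊆V₁ n) (pyramidal : Pyramidal n Q) where

  Q-inGrid : ∀ {x y} → Q x y ≡ true → inGrid n x y ≡ true
  Q-inGrid {x} {y} q = ∧-elimˡ (Q⊆V₁ x y q)

  Q-even : ∀ {x y} → Q x y ≡ true → evenB (x + y) ≡ true
  Q-even {x} {y} q = ∧-elimʳ {inGrid n x y} (Q⊆V₁ x y q)

  down-left : ∀ {x j} → Q (suc x) (2 + j) ≡ true → 1 ≤ x → Q x (suc j) ≡ true
  down-left {x} {j} q (s≤s z≤n) = proj₁ (pyramidal (suc x) (2 + j) q (s≤s (s≤s z≤n))) (s≤s (s≤s z≤n))

  down-right : ∀ {x j} → Q x (2 + j) ≡ true → suc x ≤ n → Q (suc x) (suc j) ≡ true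
  down-right {x} {j} q x<n = subst (λ x′ → Q x′ (suc j) ≡ true) (+-comm x 1)
    (proj₂ (pyramidal x (2 + j) q (s≤s (s≤s z≤n))) (∸-monoˡ-≤ 1 x<n))

  -- Two steps down (left then right, or right then left at the border) stay in the column.
  down-twice : ∀ {x j} → Q x (3 + j) ≡ true → 1 ≤ x → x ≤ n → 2 + j ≤ n → Q x (suc j) ≡ true
  down-twice {suc zero}    q _ _   2+j≤n = down-left (down-right q (≤-trans (s≤s (s≤s z≤n)) 2+j≤n)) (s≤s z≤n)
  down-twice {suc (suc x)} q _ x≤n _     = down-right (down-left q (s≤s z≤n)) x≤n

  support-below : ∀ {u w x j} → Q u w ≡ true → Adj u w x (2 + j) →
    1 ≤ x → x ≤ n → 2 + j ≤ n → Q x (suc j) ≡ true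
  support-below q (right _ _) 1≤x _   _     = down-left q 1≤x
  support-below q (left _ _)  _   x≤n _     = down-right q x≤n
  support-below q (above _ _) 1≤x x≤n 2+j≤n = down-twice q 1≤x x≤n 2+j≤n
  support-below q (below _ _) _   _   _     = q

  support-bottom : ∀ {x} → Neighbour Q x 1 → ∃ λ u → Q u 1 ≡ true × Adj u 1 x 1
  support-bottom (_ , _ , q , right x _) = suc x , q , right x 1
  support-bottom (_ , _ , q , left u _)  = u , q , left u 1
  support-bottom {zero}        (_ , _ , q , above _ _) with () ← proj₁ (inGrid-bounds {n} {0} {2} (Q-inGrid q))
  support-bottom {suc zero}    (_ , _ , q , above _ _) with () ← Q-even q
  support-bottom {suc (suc x)} (_ , _ , q , above _ _) = suc x , down-left q (s≤s z≤n) , left (suc x) 1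
  support-bottom (_ , _ , q , below u _) with () ← proj₁ (proj₂ (proj₂ (inGrid-bounds {n} {u} {0} (Q-inGrid q))))

  Nb-above-bottom : ∀ {x j} → 1 ≤ x → x ≤ n → 2 + j ≤ n → Nb n Q x (2 + j) ≡ Q x (suc j)
  Nb-above-bottom {x} {j} 1≤x x≤n 2+j≤n = bool-ext supported neighbouring
    where
    supported : Nb n Q x (2 + j) ≡ true → Q x (suc j) ≡ true
    supported e with _ , _ , q , a ← Nb-neighbour e = support-below q a 1≤x x≤n 2+j≤n
    neighbouring : Q x (suc j) ≡ true → Nb n Q x (2 + j) ≡ true
    neighbouring q = Nb-intro {n} {Q} {x} {2 + j} (inGrid-intro 1≤x x≤n (s≤s z≤n) 2+j≤n)
      (Adj-parity (below x (suc j)) (Q-even q) ∘ Q-even) (Q-inGrid q) q (below x (suc j))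

  bottom : VSet
  bottom = Nb n (Q ∩ X n 1) ∩ Xbar n 1

  Nb-bottom : ∀ x → Nb n Q x 1 ≡ bottom x 1
  Nb-bottom x = bool-ext to-bottom from-bottom
    where
    to-bottom : Nb n Q x 1 ≡ true → bottom x 1 ≡ true
    to-bottom e with u , q , a ← support-bottom (Nb-neighbour e) =
      ∧-intro (Nb-intro {n} {Q ∩ X n 1} {x} {1} xy∈G (Nb-outside {n} {Q} {x} {1} e ∘ ∧-elimˡ {Q x 1})
                        (Q-inGrid q) (∧-intro q (X-intro {n} {1} {u} (Q⊆V₁ u 1 q))) a)
              (Xbar-intro {n} {1} {x} xy∈G (Adj-parity a (Q-even q)))
      where
      xy∈G : inGrid n x 1 ≡ true
      xy∈G = Nb-inGrid {n} {Q} {x} {1} e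
    from-bottom : bottom x 1 ≡ true → Nb n Q x 1 ≡ true
    from-bottom b with _ , _ , q∩X , a ← Nb-neighbour (∧-elimˡ {Nb n (Q ∩ X n 1) x 1} b)
      = Nb-intro {n} {Q} {x} {1} (Nb-inGrid {n} {Q ∩ X n 1} {x} {1} b∈N) (Xbar-odd {n} {1} {x} {1} b∈X̄ ∘ Q-even) (Q-inGrid q) q a
      where
      b∈N : Nb n (Q ∩ X n 1) x 1 ≡ true
      b∈N = ∧-elimˡ b
      b∈X̄ : Xbar n 1 x 1 ≡ true
      b∈X̄ = ∧-elimʳ {Nb n (Q ∩ X n 1) x 1} b
      q = ∧-elimˡ q∩X

  -- Q counted at the vertex directly below (1+i , 1+j); nothing lies below row 1.
  below-count : ℕ → ℕ → ℕ
  below-count i zero    = 0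
  below-count i (suc j) = ind (Q (suc i) (suc j))

  Nb-count : ∀ {i j} → i < n → j < n →
    ind (Nb n Q (suc i) (suc j)) ≡ below-count i j + ind (bottom (suc i) (suc j))
  Nb-count {i} {zero}  _   _   = cong ind (Nb-bottom (suc i))
  Nb-count {i} {suc j} i<n j<n = begin
    ind (Nb n Q (suc i) (2 + j))                         ≡⟨ cong ind (Nb-above-bottom (s≤s z≤n) i<n j<n) ⟩
    ind (Q (suc i) (suc j))                              ≡⟨ sym (+-identityʳ _) ⟩
    ind (Q (suc i) (suc j)) + 0                          ≡⟨ cong (ind (Q (suc i) (suc j)) +_) (sym (ind-false off-row)) ⟩
    below-count i (suc j) + ind (bottom (suc i) (2 + j)) ∎
    where
    off-row : bottom (suc i) (2 + j) ≢ true
    off-row b with () ← suc-injective (Xbar-row {n} {1} {suc i} {2 + j} (∧-elimʳ {Nb n (Q ∩ X n 1) (suc i) (2 + j)} b))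

  δ-as-∑ : δ n Q ≡ ∑ n (λ i → ∑ n (below-count i)) + card n bottom
  δ-as-∑ = begin
    δ n Q                                                                 ≡⟨ card-as-∑ n (Nb n Q) ⟩
    ∑ n (λ i → ∑ n (λ j → ind (Nb n Q (suc i) (suc j))))                  ≡⟨ ∑-cong n (λ i i<n → ∑-cong n (λ j j<n → Nb-count i<n j<n)) ⟩
    ∑ n (λ i → ∑ n (λ j → below-count i j + bottom-count i j))             ≡⟨ ∑-cong n (λ i _ → ∑-+ n (below-count i) (bottom-count i)) ⟩
    ∑ n (λ i → ∑ n (below-count i) + ∑ n (bottom-count i))                ≡⟨ ∑-+ n (λ i → ∑ n (below-count i)) (λ i → ∑ n (bottom-count i)) ⟩
    ∑ n (λ i → ∑ n (below-count i)) + ∑ n (λ i → ∑ n (bottom-count i))    ≡⟨ cong (∑ n (λ i → ∑ n (below-count i)) +_) (sym (card-as-∑ n bottom)) ⟩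
    ∑ n (λ i → ∑ n (below-count i)) + card n bottom                       ∎
    where
    bottom-count : ℕ → ℕ → ℕ
    bottom-count i j = ind (bottom (suc i) (suc j))

card-below-top : ∀ m (Q : VSet) → Q ⊆V₁ (suc m) →
  card (suc m) Q ∸ card (suc m) (Q ∩ X (suc m) (suc m)) ≡ ∑ (suc m) (λ i → ∑ m (λ j → ind (Q (suc i) (suc j))))
card-below-top m Q Q⊆V₁ = begin
  card n Q ∸ card n (Q ∩ X n n)  ≡⟨ cong₂ _∸_ (card-split-top m Q) (card-split-top m (Q ∩ X n n)) ⟩
  (lower + top) ∸ (∑ n (λ i → ∑ m (λ j → ind ((Q ∩ X n n) (suc i) (suc j)))) + ∑ n (λ i → ind ((Q ∩ X n n) (suc i) n)))
                                 ≡⟨ cong₂ (λ a b → (lower + top) ∸ (a + b)) lower-vanishes top-agrees ⟩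
  (lower + top) ∸ top            ≡⟨ m+n∸n≡m lower top ⟩
  lower                          ∎
  where
  n = suc m
  lower = ∑ n (λ i → ∑ m (λ j → ind (Q (suc i) (suc j))))
  top = ∑ n (λ i → ind (Q (suc i) n))
  lower-vanishes : ∑ n (λ i → ∑ m (λ j → ind ((Q ∩ X n n) (suc i) (suc j)))) ≡ 0
  lower-vanishes = ∑-vanish n (λ i _ → ∑-vanish m (λ j j<m → ind-false (λ q∈X →
    <⇒≢ (s≤s j<m) (X-row {n} {n} {suc i} {suc j} (∧-elimʳ {Q (suc i) (suc j)} q∈X)))))
  top-agrees : ∑ n (λ i → ind ((Q ∩ X n n) (suc i) n)) ≡ top
  top-agrees = ∑-cong n (λ i _ → cong ind (bool-ext (∧-elimˡ {Q (suc i) n})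
    (λ q → ∧-intro q (X-intro {n} {n} {suc i} (Q⊆V₁ (suc i) n q)))))

lemma5 : (n : ℕ) (Q : VSet) → Q ⊆V₁ n → Pyramidal n Q →
    δ n Q ≡ (card n Q ∸ card n (Q ∩ X n n)) + card n (Nb n (Q ∩ X n 1) ∩ Xbar n 1)
lemma5 zero    _ _    _         = refl
lemma5 (suc m) Q Q⊆V₁ pyramidal = begin
  δ n Q                                                                 ≡⟨ δ-as-∑ ⟩
  ∑ n (λ i → ∑ m (λ j → ind (Q (suc i) (suc j)))) + card n bottom       ≡⟨ cong (_+ card n bottom) (sym (card-below-top m Q Q⊆V₁)) ⟩
  (card n Q ∸ card n (Q ∩ X n n)) + card n bottom                       ∎
  where
  n = suc m
  open PyramidalSet n Q Q⊆V₁ pyramidal
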